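{- Let $E$ be a binary smooth relation on $\mathbb{Q}^k$ that is preserved by $\langle\ell\ell\rangle$. Let $S\subseteq E$ be smooth such that $S'$ contains a min-clean tuple $\binom{u^1}{v^1}$. Then there exist $I\subseteq[k]$, $m,n\ge1$, $q\in\mathbb{Q}$, and $\binom{u^2}{v^2},\dots,\binom{u^n}{v^n}\in S'$ such that for all $\binom{u}{v}\in S'$ the tuple $\binom{u'}{v'}:=\ell\ell_q^{(n+1)}\left(\binom{u^1}{v^1},\dots,\binom{u^n}{v^n},\binom{u}{v}\right)$ satisfies: (i) $I_m(u')=I_m(v')=I$ and $u'\sim_I v'$; (ii) $u'\sim_{[k]\setminus I}u$ and $v'\sim_{[k]\setminus I}v$.
   Context: $[k]=\{1,\dots,k\}$. For $a\in\mathbb{Q}^k$: $\min(a)$ its least entry, $\mathrm{minx}(a)=\{i:a_i=\min(a)\}$, $I_m(a)$ the set of indices carrying one of the $m$ smallest values of $a$. $a\sim_\ell b$ iff $a_i\le a_j\Leftrightarrow b_i\le b_j$ for all $i,j$; $a\sim_I b$ iff the subtuples on $I$ are $\sim_{|I|}$-related. A binary relation on $\mathbb{Q}^k$ is a nonempty $E\subseteq\mathbb{Q}^k\times\mathbb{Q}^k=\mathbb{Q}^{2k}$; smooth means the sets of first and second components coincide. For $t=(t_1,t_2)$, $\min(t)$ is its least entry, $M(t)=\{i:\min(t_i)=\min(t)\}$, $t$ min-clean if $\mathrm{minx}(t_i)=\mathrm{minx}(t_j)$ for $i,j\in M(t)$. For $a\in\mathbb{Q}^N$, $\ker(a)=\{(i,j):a_i=a_j\}$.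 $lex$ is a binary operation on $\mathbb{Q}$ with $lex(x,y)<lex(x',y')$ iff $x<x'$ or ($x=x'$ and $y<y'$). For $q\in\mathbb{Q}$, $\ell\ell_q$ is a binary operation with $\ell\ell_q(x,y)<\ell\ell_q(x',y')$ iff one of: $x\le q$ and $x<x'$; $x\le q$, $x=x'$, $y<y'$; $x,x'>q$ and $y<y'$; $x,x'>q$, $y=y'$, $x<x'$. $\ell\ell=\ell\ell_0$. For an operation $f$, $\langle f\rangle$ is the smallest set of operations containing $f$, all automorphisms of $(\mathbb{Q};<)$, all projections, closed under composition and interpolation; operations act componentwise. $\langle S\rangle_{lex}$ is the smallest superset of $S$ in $\mathbb{Q}^{2k}$ preserved by all of $\langle lex\rangle$, and $S'=\{t\in\langle S\rangle_{lex}:\ker t=\bigcap_{s\in S}\ker s\}$. For binary $f$, $f^{(m)}(x_1,\dots,x_m)=f(x_1,f(x_2,\dots,f(x_{m-1},x_m)\dots))$. -}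

module Defs where

open import Data.Nat as ℕ using (ℕ; zero; suc)
open import Data.Rational as ℚ using (ℚ; _<_; _≤_; _<?_; _≟_)
open import Data.Fin using (Fin; zero; suc)
open import Data.Fin.Subset using (Subset; _∈_; inside; outside)
open import Data.Vec using (Vec; []; _∷_; lookup; tabulate; map; toList; zipWith; head)
open import Data.List as List using (List; length; filter; deduplicate)
open import Data.List.Relation.Unary.All as LAll using ()
open import Data.Product using (Σ; ∃; _×_; _,_; proj₁; proj₂)
open import Data.Bool using (Bool)
open import Function.Bundles using (_⇔_)
open import Relation.Binary.PropositionalEquality using (_≡_)
open import Relation.Nullary.Decidable using (⌊_⌋)

Op : ℕ → Set
Op n = Vec ℚ n → ℚ

bin→Op : (ℚ → ℚ → ℚ) → Op 2
bin→Op f xs = f (lookup xs zero) (lookup xs (suc zero))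

IsAut : (ℚ → ℚ) → Set
IsAut α = (∀ x y → (x < y) ⇔ (α x < α y)) × (∀ y → ∃ λ x → α x ≡ y)

IsLex : (ℚ → ℚ → ℚ) → Set
IsLex f = ∀ x y x' y' →
  (f x y < f x' y') ⇔ ((x < x') Data.Sum.⊎ ((x ≡ x') × (y < y')))
  where import Data.Sum

IsLL : ℚ → (ℚ → ℚ → ℚ) → Set
IsLL q f = ∀ x y x' y' →
  (f x y < f x' y') ⇔
    ( ((x ≤ q) × (x < x'))
    ⊎ ((x ≤ q) × (x ≡ x') × (y < y'))
    ⊎ ((q < x) × (q < x') × (y < y'))
    ⊎ ((q < x) × (q < x') × (y ≡ y') × (x < x')) )
  where open import Data.Sum using (_⊎_)

-- ⟨ f ⟩ : smallest set of operations containing f, all automorphisms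
-- of (ℚ;<), all projections, closed under composition and interpolation
-- (local closure).
data Gen (f : Op 2) : (n : ℕ) → Op n → Set where
  base   : Gen f 2 f
  aut    : (α : ℚ → ℚ) → IsAut α → Gen f 1 (λ xs → α (head xs))
  proj   : ∀ {n} (i : Fin n) → Gen f n (λ xs → lookup xs i)
  comp   : ∀ {m n} {g : Op m} {hs : Fin m → Op n} →
           Gen f m g → (∀ i → Gen f n (hs i)) →
           Gen f n (λ xs → g (tabulate (λ i → hs i xs)))
  interp : ∀ {n} {g : Op n} →
           (∀ (F : List (Vec ℚ n)) →
              Σ (Op n) λ h → Gen f n h × LAll.All (λ x → h x ≡ g x) F) →
           Gen f n g

-- Tuples of ℚ^{2k} = ℚ^k × ℚ^k and binary relations

Tup : ℕ → Set
Tup k = Vec ℚ k × Vec ℚ k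

comp₂ : ∀ {k} → Tup k → Fin 2 → Vec ℚ k
comp₂ t zero = proj₁ t
comp₂ t (suc _) = proj₂ t

entry : ∀ {k} → Tup k → Fin 2 × Fin k → ℚ
entry t (c , i) = lookup (comp₂ t c) i

Rel : ℕ → Set₁
Rel k = Tup k → Set

IsBinRel : ∀ {k} → Rel k → Set
IsBinRel R = ∃ λ t → R t

Smooth : ∀ {k} → Rel k → Set
Smooth R = IsBinRel R ×
  (∀ a → (∃ λ t → R t × proj₁ t ≡ a) ⇔ (∃ λ t → R t × proj₂ t ≡ a))

applyOp : ∀ {k n} → Op n → (Fin n → Tup k) → Tup k
applyOp g ts =
  tabulate (λ i → g (tabulate (λ j → lookup (proj₁ (ts j)) i))) ,
  tabulate (λ i → g (tabulate (λ j → lookup (proj₂ (ts j)) i)))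

Preserves : ∀ {k n} → Op n → Rel k → Set
Preserves {k} {n} g R = ∀ (ts : Fin n → Tup k) → (∀ j → R (ts j)) → R (applyOp g ts)

PreservedByClone : ∀ {k} → Op 2 → Rel k → Set
PreservedByClone f R = ∀ n (g : Op n) → Gen f n g → Preserves g R

data LexClo {k} (lex : ℚ → ℚ → ℚ) (S : Rel k) : Tup k → Set where
  inS : ∀ {t} → S t → LexClo lex S t
  app : ∀ {n} {g : Op n} → Gen (bin→Op lex) n g →
        (ts : Fin n → Tup k) → (∀ j → LexClo lex S (ts j)) →
        LexClo lex S (applyOp g ts)

InKer : ∀ {k} → Tup k → (Fin 2 × Fin k) → (Fin 2 × Fin k) → Set
InKer t p p' = entry t p ≡ entry t p'

S′ : ∀ {k} → (ℚ → ℚ → ℚ) → Rel k → Rel k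
S′ lex S t = LexClo lex S t ×
  (∀ p p' → InKer t p p' ⇔ (∀ s → S s → InKer s p p'))

InMinx : ∀ {k} → Vec ℚ k → Fin k → Set
InMinx a i = ∀ j → lookup a i ≤ lookup a j

InM : ∀ {k} → Tup k → Fin 2 → Set
InM t c = ∃ λ i → ∀ p → lookup (comp₂ t c) i ≤ entry t p

MinClean : ∀ {k} → Tup k → Set
MinClean t = ∀ c c' → InM t c → InM t c' →
  ∀ i → InMinx (comp₂ t c) i ⇔ InMinx (comp₂ t c') i

rank : ∀ {k} → Vec ℚ k → Fin k → ℕ
rank a i = length (deduplicate _≟_ (filter (_<? lookup a i) (toList a)))

I[_] : ∀ {k} → ℕ → Vec ℚ k → Subset k
I[ m ] a = tabulate (λ i → ⌊ rank a i ℕ.<? m ⌋)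

SimOn : ∀ {k} → Subset k → Vec ℚ k → Vec ℚ k → Set
SimOn I a b = ∀ i j → i ∈ I → j ∈ I →
  (lookup a i ≤ lookup a j) ⇔ (lookup b i ≤ lookup b j)

binT : ∀ {k} → (ℚ → ℚ → ℚ) → Tup k → Tup k → Tup k
binT f s t = zipWith f (proj₁ s) (proj₁ t) , zipWith f (proj₂ s) (proj₂ t)

iterT : ∀ {k m} → (ℚ → ℚ → ℚ) → Vec (Tup k) (suc m) → Tup k
iterT f (t ∷ []) = t
iterT f (t ∷ t' ∷ ts) = binT f t (iterT f (t' ∷ ts))

module Submission where

-- Take q = μ, the least entry of t₁.  In a coordinate of ℓℓ_q(x₁, ℓℓ_q(x₂, …, ℓℓ_q(xₙ, y)…))
-- the arguments x_j ≤ q decide: coordinates are ordered first by the first level j with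
-- x_j ≤ q (where the coordinate drops), then by that x_j; coordinates that never drop are
-- ordered as in y.
-- Ties cause no trouble because all tuples of S′ share one kernel.
--
-- If both components of t₁ attain μ, min-cleanness makes them attain it on the same set I,
-- and t₁ alone separates I.  Otherwise only one component of t₁, say the first, attains μ,
-- on a set J.  Given a link p ∈ S′ whose first component drops exactly on a set P of the
-- coordinates still in play, the next link T ∈ S′ is lex(p̃, p), where p̃ ∈ ⟨S⟩_lex has the
-- first component of p as its second component (smoothness of S), translated so that its
-- second component drops exactly on P, ordered there like the first component of p.  The
-- coordinates in play where the first component of T drops form the next level; we stop when
-- it is empty, and I is the union of the levels.  On I the first component drops one level
-- before the second and in the same order, so u′ ∼_I v′; outside I nothing drops, so u′ and
-- v′ are ordered as u and v.  Finally I = I_m(u′) = I_m(v′) for m the number of distinct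
-- values on I, which does not depend on the last tuple, again by the common kernel.

open import Defs
open import Data.Bool using (true; false)
open import Data.Fin using (Fin; zero; suc; opposite)
open import Data.Fin.Subset
  using (Subset; inside; outside; _∈_; _∉_; _⊆_; _∪_; _∩_; _─_; ∁; ∣_∣; Nonempty; Lift)
  renaming (⊥ to ∅)
open import Data.Fin.Subset.Properties
  using ( _∈?_; nonempty?; ∉⊥; ⊥⊆; ∣p∣≤n; x∈p∪q⁻; x∈p∪q⁺; x∈p∩q⁺; p∩q⊆p; p∩q⊆q; p─q⊆p
        ; x∈p∧x∉q⇒x∈p─q; x∈∁p⇒x∉p; x∉p⇒x∈∁p; p∩q≢∅⇒∣p─q∣<∣p∣)
open import Data.List using (List; []; _∷_; length; map; filter; deduplicate; allFin)
import Data.List.Extrema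
open import Data.List.Membership.Propositional using () renaming (_∈_ to _∈ₗ_; _∉_ to _∉ₗ_)
open import Data.List.Membership.Propositional.Properties
  using (∈-filter⁺; ∈-filter⁻; ∈-map⁺; ∈-map⁻; ∈-allFin; ∈-deduplicate⁺; ∈-deduplicate⁻)
open import Data.List.Properties using (filter-all; filter-≐; length-map)
open import Data.List.Relation.Binary.Subset.Propositional using () renaming (_⊆_ to _⊆ₗ_)
import Data.List.Relation.Unary.All as ListAll
open import Data.List.Relation.Unary.AllPairs using ([]; _∷_)
import Data.List.Relation.Unary.AllPairs.Properties as AllPairs
open import Data.List.Relation.Unary.Any using (here; there)
open import Data.List.Relation.Unary.Unique.Propositional using (Unique)
open import Data.List.Relation.Unary.Unique.DecPropositional.Properties using (deduplicate-!)
open import Data.Nat using (ℕ; zero; suc; _≤_; z≤n; s≤s)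
import Data.Nat as ℕ
import Data.Nat.Properties as ℕ
open import Data.Product using (Σ; ∃; ∃₂; _×_; _,_; proj₁; proj₂)
open import Data.Rational using (ℚ; 0ℚ; _<_; _+_; _-_; _<?_; _≟_)
import Data.Rational as ℚ
open import Data.Rational.Properties
  using ( <-cmp; <-irrefl; <-asym; <-trans; <-≤-trans; ≤-<-trans; ≤-refl; ≤-reflexive; ≤-trans; ≤-antisym
        ; <⇒≤; <⇒≢; ≰⇒>; ≤-decTotalOrder; +-comm; +-monoˡ-<; +-monoˡ-≤)
import Data.Rational.Properties as ℚ
open import Algebra.Properties.Group ℚ.+-0-group using (∙-cancelʳ; //-rightDividesˡ)
open import Data.Sum using (inj₁; inj₂)
open import Data.Vec using (Vec; []; _∷_; _∷ʳ_; here; there; lookup; tabulate; zipWith; head; toList)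
open import Data.Vec.Membership.Propositional.Properties using (∈-toList⁺; ∈-toList⁻; ∈-lookup)
open import Data.Vec.Properties
  using (lookup∘tabulate; tabulate∘lookup; tabulate-cong; lookup-zipWith; []=⇒lookup; lookup⇒[]=)
open import Data.Vec.Relation.Unary.All using (All; []; _∷_)
open import Data.Vec.Relation.Unary.Any using (index)
open import Data.Vec.Relation.Unary.Any.Properties using (lookup-index)
open import Function using (_∘_; case_of_)
open import Function.Bundles using (_⇔_; mk⇔; Equivalence)
open import Function.Properties.Equivalence using (⇔-setoid)
import Level
open import Relation.Binary.Bundles using (DecTotalOrder; Setoid)
open import Relation.Binary.Definitions using (DecidableEquality; tri<; tri≈; tri>)
open import Relation.Binary.PropositionalEquality
  using (_≡_; _≢_; refl; sym; trans; cong; cong₂; subst; subst₂; ≢-sym; module ≡-Reasoning)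
import Relation.Binary.Reasoning.Setoid
open import Relation.Nullary using (¬_; ¬?; Dec; yes; no; does; contradiction)
open import Relation.Nullary.Decidable using (⌊_⌋; isYes≗does; dec-true; dec-false)

open Equivalence using (to; from)
open Setoid (⇔-setoid Level.zero) using () renaming (refl to ⇔-refl; sym to ⇔-sym; trans to ⇔-trans)

private variable n : ℕ

-- Orders on ℚ: lex, ℓℓ_q and translations

≤⇒≯ : ∀ {x y} → x ℚ.≤ y → ¬ y < x
≤⇒≯ x≤y y<x = <-irrefl refl (<-≤-trans y<x x≤y)

≤⇔≤-transfer : ∀ {x x′ X X′} → (x < x′ → X < X′) → (x′ < x → X′ < X) → (x ≡ x′ → X ≡ X′) →
               (X ℚ.≤ X′) ⇔ (x ℚ.≤ x′)
≤⇔≤-transfer {x} {x′} {X} {X′} mono-< mono-> mono-≡ = mk⇔ reflect preserve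
  where
  reflect : X ℚ.≤ X′ → x ℚ.≤ x′
  reflect X≤X′ with <-cmp x x′
  ... | tri< x<x′ _ _ = <⇒≤ x<x′
  ... | tri≈ _ x≡x′ _ = ≤-reflexive x≡x′
  ... | tri> _ _ x′<x = contradiction (mono-> x′<x) (≤⇒≯ X≤X′)
  preserve : x ℚ.≤ x′ → X ℚ.≤ X′
  preserve x≤x′ with <-cmp x x′
  ... | tri< x<x′ _ _ = <⇒≤ (mono-< x<x′)
  ... | tri≈ _ x≡x′ _ = ≤-reflexive (mono-≡ x≡x′)
  ... | tri> _ _ x′<x = contradiction x′<x (≤⇒≯ x≤x′)

injective₂-by-< : (f : ℚ → ℚ → ℚ) →
                  (∀ {x x′ y y′} → x < x′ → f x y ≢ f x′ y′) →
                  (∀ {x y y′} → y < y′ → f x y ≢ f x y′) →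
                  ∀ {x x′ y y′} → f x y ≡ f x′ y′ → x ≡ x′ × y ≡ y′
injective₂-by-< f apart₁ apart₂ {x} {x′} {y} {y′} eq with <-cmp x x′ | <-cmp y y′
... | tri< x<x′ _ _ | _             = contradiction eq (apart₁ x<x′)
... | tri> _ _ x′<x | _             = contradiction (sym eq) (apart₁ x′<x)
... | tri≈ _ refl _ | tri< y<y′ _ _ = contradiction eq (apart₂ y<y′)
... | tri≈ _ refl _ | tri> _ _ y′<y = contradiction (sym eq) (apart₂ y′<y)
... | tri≈ _ refl _ | tri≈ _ y≡y′ _ = refl , y≡y′

module Lex {lex : ℚ → ℚ → ℚ} (isLex : IsLex lex) where

  <₁ : ∀ {x x′ y y′} → x < x′ → lex x y < lex x′ y′
  <₁ {x} {x′} {y} {y′} x<x′ = from (isLex x y x′ y′) (inj₁ x<x′)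

  <₂ : ∀ {x y y′} → y < y′ → lex x y < lex x y′
  <₂ {x} {y} {y′} y<y′ = from (isLex x y x y′) (inj₂ (refl , y<y′))

  injective : ∀ {x x′ y y′} → lex x y ≡ lex x′ y′ → x ≡ x′ × y ≡ y′
  injective = injective₂-by-< lex (<⇒≢ ∘ <₁) (<⇒≢ ∘ <₂)

  ≤⇔≤₁ : ∀ {x x′ y y′} → (x ≡ x′ → y ≡ y′) → (lex x y ℚ.≤ lex x′ y′) ⇔ (x ℚ.≤ x′)
  ≤⇔≤₁ link = ≤⇔≤-transfer <₁ <₁ (λ x≡x′ → cong₂ lex x≡x′ (link x≡x′))

module LL {q : ℚ} {f : ℚ → ℚ → ℚ} (isLL : IsLL q f) where

  <-low : ∀ {x x′ y y′} → x ℚ.≤ q → x < x′ → f x y < f x′ y′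
  <-low {x} {x′} {y} {y′} x≤q x<x′ = from (isLL x y x′ y′) (inj₁ (x≤q , x<x′))

  <-low₂ : ∀ {x y y′} → x ℚ.≤ q → y < y′ → f x y < f x y′
  <-low₂ {x} {y} {y′} x≤q y<y′ = from (isLL x y x y′) (inj₂ (inj₁ (x≤q , refl , y<y′)))

  <-high : ∀ {x x′ y y′} → q < x → q < x′ → y < y′ → f x y < f x′ y′
  <-high {x} {x′} {y} {y′} q<x q<x′ y<y′ = from (isLL x y x′ y′) (inj₂ (inj₂ (inj₁ (q<x , q<x′ , y<y′))))

  <-high₁ : ∀ {x x′ y} → q < x → q < x′ → x < x′ → f x y < f x′ y
  <-high₁ {x} {x′} {y} q<x q<x′ x<x′ = from (isLL x y x′ y) (inj₂ (inj₂ (inj₂ (q<x , q<x′ , refl , x<x′))))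

  <-low-high : ∀ {x x′ y y′} → x ℚ.≤ q → q < x′ → f x y < f x′ y′
  <-low-high x≤q q<x′ = <-low x≤q (≤-<-trans x≤q q<x′)

  injective : ∀ {x x′ y y′} → f x y ≡ f x′ y′ → x ≡ x′ × y ≡ y′
  injective = injective₂-by-< f apart₁ apart₂
    where
    apart-high : ∀ {x x′ y y′} → q < x → q < x′ → x < x′ → f x y ≢ f x′ y′
    apart-high {y = y} {y′} q<x q<x′ x<x′ with <-cmp y y′
    ... | tri< y<y′ _ _ = <⇒≢ (<-high q<x q<x′ y<y′)
    ... | tri≈ _ refl _ = <⇒≢ (<-high₁ q<x q<x′ x<x′)
    ... | tri> _ _ y′<y = ≢-sym (<⇒≢ (<-high q<x′ q<x y′<y))
    apart₁ : ∀ {x x′ y y′} → x < x′ → f x y ≢ f x′ y′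
    apart₁ {x} x<x′ with x ℚ.≤? q
    ... | yes x≤q = <⇒≢ (<-low x≤q x<x′)
    ... | no x≰q  = apart-high (≰⇒> x≰q) (<-trans (≰⇒> x≰q) x<x′) x<x′
    apart₂ : ∀ {x y y′} → y < y′ → f x y ≢ f x y′
    apart₂ {x} y<y′ with x ℚ.≤? q
    ... | yes x≤q = <⇒≢ (<-low₂ x≤q y<y′)
    ... | no x≰q  = <⇒≢ (<-high (≰⇒> x≰q) (≰⇒> x≰q) y<y′)

  ≤⇔≤-low : ∀ {x x′ y y′} → x ℚ.≤ q → x′ ℚ.≤ q → (x ≡ x′ → y ≡ y′) → (f x y ℚ.≤ f x′ y′) ⇔ (x ℚ.≤ x′)
  ≤⇔≤-low x≤q x′≤q link = ≤⇔≤-transfer (<-low x≤q) (<-low x′≤q) (λ x≡x′ → cong₂ f x≡x′ (link x≡x′))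

  ≤⇔≤-high : ∀ {x x′ y y′} → q < x → q < x′ → (y ≡ y′ → x ≡ x′) → (f x y ℚ.≤ f x′ y′) ⇔ (y ℚ.≤ y′)
  ≤⇔≤-high q<x q<x′ link =
    ≤⇔≤-transfer (<-high q<x q<x′) (<-high q<x′ q<x) (λ y≡y′ → cong₂ f (link y≡y′) y≡y′)

+-cancelʳ-< : ∀ c {x y} → x + c < y + c → x < y
+-cancelʳ-< c x+c<y+c = ≰⇒> (λ y≤x → ≤⇒≯ (+-monoˡ-≤ c y≤x) x+c<y+c)

+-isAut : ∀ c → IsAut (_+ c)
+-isAut c = (λ x y → mk⇔ (+-monoˡ-< c) (+-cancelʳ-< c)) , (λ y → y - c , //-rightDividesˡ c y)

+-≤⇔ : ∀ c {x y} → (x + c ℚ.≤ y + c) ⇔ (x ℚ.≤ y)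
+-≤⇔ c = ≤⇔≤-transfer (+-monoˡ-< c) (+-monoˡ-< c) (cong (_+ c))

-- Orders on sets of coordinates

-- A record rather than a function type, so that A, B and x can be inferred.
record Below (A B : Subset n) (x : Vec ℚ n) : Set where
  constructor mkBelow
  field
    separates : ∀ {i j} → i ∈ A → j ∈ B → lookup x i < lookup x j
open Below

AtMostOn : ℚ → Vec ℚ n → Subset n → Set
AtMostOn q x = Lift (λ i → lookup x i ℚ.≤ q)

AboveOn : ℚ → Vec ℚ n → Subset n → Set
AboveOn q x = Lift (λ i → q < lookup x i)

atMost : ℚ → Vec ℚ n → Subset n
atMost q x = tabulate (λ i → does (lookup x i ℚ.≤? q))

∈-atMost⇔ : ∀ {q} (x : Vec ℚ n) i → i ∈ atMost q x ⇔ lookup x i ℚ.≤ q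
∈-atMost⇔ {q = q} x i = mk⇔
  (λ i∈ → does-true (lookup x i ℚ.≤? q) (trans (sym (lookup∘tabulate _ i)) ([]=⇒lookup i∈)))
  (λ x≤q → lookup⇒[]= i _ (trans (lookup∘tabulate _ i) (dec-true (lookup x i ℚ.≤? q) x≤q)))
  where
  does-true : ∀ {P : Set} (P? : Dec P) → does P? ≡ true → P
  does-true (yes p) _ = p

x∈p─q⇒x∉q : ∀ {p q : Subset n} {x} → x ∈ p ─ q → x ∉ q
x∈p─q⇒x∉q {p = _ ∷ _} {q = outside ∷ _} here ()
x∈p─q⇒x∉q {p = _ ∷ _} {q = _ ∷ _} (there x∈p─q) (there x∈q) = x∈p─q⇒x∉q x∈p─q x∈q

Lift-∪ : ∀ {P : Fin n → Set} {A B : Subset n} → Lift P A → Lift P B → Lift P (A ∪ B)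
Lift-∪ {A = A} {B} PA PB i∈ with x∈p∪q⁻ A B i∈
... | inj₁ i∈A = PA i∈A
... | inj₂ i∈B = PB i∈B

Below-⊆ʳ : ∀ {A B B′ : Subset n} {x} → B′ ⊆ B → Below A B x → Below A B′ x
Below-⊆ʳ B′⊆B A↑B = mkBelow λ i∈ j∈ → separates A↑B i∈ (B′⊆B j∈)

Below-∪ˡ : ∀ {A B C : Subset n} {x} → Below A C x → Below B C x → Below (A ∪ B) C x
Below-∪ˡ {A = A} {B} A↑C B↑C = mkBelow λ i∈ j∈ → case x∈p∪q⁻ A B i∈ of λ where
  (inj₁ i∈A) → separates A↑C i∈A j∈
  (inj₂ i∈B) → separates B↑C i∈B j∈

SimOn-setoid : Subset n → Setoid Level.zero Level.zero
SimOn-setoid {n} A = record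
  { Carrier       = Vec ℚ n
  ; _≈_           = SimOn A
  ; isEquivalence = record
    { refl  = λ _ _ _ _ → ⇔-refl
    ; sym   = λ x∼y i j i∈ j∈ → ⇔-sym (x∼y i j i∈ j∈)
    ; trans = λ x∼y y∼z i j i∈ j∈ → ⇔-trans (x∼y i j i∈ j∈) (y∼z i j i∈ j∈)
    }
  }

module SimOn-Reasoning {n} (A : Subset n) = Relation.Binary.Reasoning.Setoid (SimOn-setoid A)

SimOn-⊆ : ∀ {A B : Subset n} x y → B ⊆ A → SimOn A x y → SimOn B x y
SimOn-⊆ x y B⊆A x∼y i j i∈ j∈ = x∼y i j (B⊆A i∈) (B⊆A j∈)

SimOn-const : ∀ {A : Subset n} x y {c d} →
              Lift (λ i → lookup x i ≡ c) A → Lift (λ i → lookup y i ≡ d) A → SimOn A x y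
SimOn-const x y x≡c y≡d i j i∈ j∈ =
  mk⇔ (λ _ → ≤-reflexive (trans (y≡d i∈) (sym (y≡d j∈))))
      (λ _ → ≤-reflexive (trans (x≡c i∈) (sym (x≡c j∈))))

SimOn-∪ : ∀ {A B : Subset n} x y → SimOn A x y → SimOn B x y →
          Below A B x → Below A B y → SimOn (A ∪ B) x y
SimOn-∪ {A = A} {B} x y onA onB x↑ y↑ i j i∈ j∈ with x∈p∪q⁻ A B i∈ | x∈p∪q⁻ A B j∈
... | inj₁ i∈A | inj₁ j∈A = onA i j i∈A j∈A
... | inj₂ i∈B | inj₂ j∈B = onB i j i∈B j∈B
... | inj₁ i∈A | inj₂ j∈B = mk⇔ (λ _ → <⇒≤ (separates y↑ i∈A j∈B)) (λ _ → <⇒≤ (separates x↑ i∈A j∈B))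
... | inj₂ i∈B | inj₁ j∈A = mk⇔ (λ x≤ → contradiction (separates x↑ j∈A i∈B) (≤⇒≯ x≤))
                                (λ y≤ → contradiction (separates y↑ j∈A i∈B) (≤⇒≯ y≤))

both-columns : ∀ {P : Fin 2 → Set} a → P a → P (opposite a) → ∀ c → P c
both-columns zero       Pa Pb zero       = Pa
both-columns zero       Pa Pb (suc zero) = Pb
both-columns (suc zero) Pa Pb zero       = Pb
both-columns (suc zero) Pa Pb (suc zero) = Pa

SimOn-all-columns : ∀ {A : Subset n} (v : Fin 2 → Vec ℚ n) a → SimOn A (v a) (v (opposite a)) →
                    ∀ c c′ → SimOn A (v c) (v c′)
SimOn-all-columns {A = A} v a v∼ =
  both-columns a (both-columns a (∼.refl {v a}) v∼)
                 (both-columns a (∼.sym {v a} {v (opposite a)} v∼) (∼.refl {v (opposite a)}))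
  where module ∼ = Setoid (SimOn-setoid A)

members : Subset n → List (Fin n)
members p = filter (_∈? p) (allFin _)

∈-members⁺ : ∀ {p : Subset n} {i} → i ∈ p → i ∈ₗ members p
∈-members⁺ i∈p = ∈-filter⁺ (_∈? _) (∈-allFin _) i∈p

∈-members⁻ : ∀ {p : Subset n} {i} → i ∈ₗ members p → i ∈ p
∈-members⁻ i∈ = proj₂ (∈-filter⁻ (_∈? _) {xs = allFin _} i∈)

module Extrema = Data.List.Extrema (DecTotalOrder.totalOrder ≤-decTotalOrder)

argmaxOn : (v : Fin n → ℚ) (P : Subset n) → Nonempty P →
           ∃ λ m → m ∈ P × (∀ {i} → i ∈ P → v i ℚ.≤ v m)
argmaxOn v P (i₀ , i₀∈P) =
  m , argmax-all v i₀∈P (ListAll.tabulate ∈-members⁻) ,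
  λ i∈P → ListAll.lookup (f[xs]≤f[argmax] i₀ (members P)) (∈-members⁺ i∈P)
  where
  open Extrema
  m = argmax v i₀ (members P)

argmin-lookup : (x : Vec ℚ n) → Fin n → ∃ λ i₀ → ∀ i → lookup x i₀ ℚ.≤ lookup x i
argmin-lookup {n} x i =
  argmin (lookup x) i (allFin n) , λ j → ListAll.lookup (f[argmin]≤f[xs] i (allFin n)) (∈-allFin j)
  where open Extrema

InMinx⇔≤min : ∀ (x : Vec ℚ n) {i₀} → (∀ i → lookup x i₀ ℚ.≤ lookup x i) →
              ∀ i → InMinx x i ⇔ lookup x i ℚ.≤ lookup x i₀
InMinx⇔≤min x x-min i = mk⇔ (λ i-min → i-min _) (λ xᵢ≤μ j → ≤-trans xᵢ≤μ (x-min j))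

-- Counting distinct values

module _ {A : Set} (_≟ᴬ_ : DecidableEquality A) where

  length≤1+filter≢ : ∀ y {xs} → Unique xs → length xs ≤ suc (length (filter (¬? ∘ (_≟ᴬ y)) xs))
  length≤1+filter≢ y {[]} _ = z≤n
  length≤1+filter≢ y {x ∷ xs} (x∉xs ∷ xs!) with x ≟ᴬ y
  ... | yes refl rewrite filter-all (¬? ∘ (_≟ᴬ y)) (ListAll.map (λ x≢z z≡x → x≢z (sym z≡x)) x∉xs) = ℕ.≤-refl
  ... | no _ = s≤s (length≤1+filter≢ y xs!)

  unique-⊆⇒length≤ : ∀ {xs ys} → Unique xs → xs ⊆ₗ ys → length xs ≤ length ys
  unique-⊆⇒length≤ {[]} _ _ = z≤n
  unique-⊆⇒length≤ {_ ∷ _} {[]} _ xs⊆[] with () ← xs⊆[] (here refl)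
  unique-⊆⇒length≤ {xs@(_ ∷ _)} {y ∷ ys} xs! xs⊆ =
    ℕ.≤-trans (length≤1+filter≢ y xs!)
              (s≤s (unique-⊆⇒length≤ (AllPairs.filter⁺ (¬? ∘ (_≟ᴬ y)) xs!) xs∖y⊆ys))
    where
    xs∖y⊆ys : filter (¬? ∘ (_≟ᴬ y)) xs ⊆ₗ ys
    xs∖y⊆ys z∈ with ∈-filter⁻ (¬? ∘ (_≟ᴬ y)) z∈
    ... | z∈xs , z≢y with xs⊆ z∈xs
    ... | here z≡y   = contradiction z≡y z≢y
    ... | there z∈ys = z∈ys

  private
    dedup : List A → List A
    dedup = deduplicate _≟ᴬ_

    dedup-⊆ : ∀ {xs ys} → xs ⊆ₗ ys → dedup xs ⊆ₗ dedup ys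
    dedup-⊆ {xs} xs⊆ys z∈ = ∈-deduplicate⁺ _≟ᴬ_ (xs⊆ys (∈-deduplicate⁻ _≟ᴬ_ xs z∈))

  length-deduplicate-mono : ∀ {xs ys} → xs ⊆ₗ ys → length (dedup xs) ≤ length (dedup ys)
  length-deduplicate-mono {xs} xs⊆ys = unique-⊆⇒length≤ (deduplicate-! _≟ᴬ_ xs) (dedup-⊆ xs⊆ys)

  length-deduplicate-mono-< : ∀ {xs ys z} → xs ⊆ₗ ys → z ∈ₗ ys → z ∉ₗ xs →
                              length (dedup xs) ℕ.< length (dedup ys)
  length-deduplicate-mono-< {xs} {ys} {z} xs⊆ys z∈ys z∉xs =
    unique-⊆⇒length≤ (z∉dedup ∷ deduplicate-! _≟ᴬ_ xs) z∷dedup⊆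
    where
    z∉dedup : ListAll.All (z ≢_) (dedup xs)
    z∉dedup = ListAll.tabulate λ { w∈ refl → z∉xs (∈-deduplicate⁻ _≟ᴬ_ xs w∈) }
    z∷dedup⊆ : z ∷ dedup xs ⊆ₗ dedup ys
    z∷dedup⊆ (here refl) = ∈-deduplicate⁺ _≟ᴬ_ z∈ys
    z∷dedup⊆ (there w∈)  = dedup-⊆ xs⊆ys w∈

filter-map : ∀ {A B : Set} {P : B → Set} (P? : ∀ y → Dec (P y)) (f : A → B) xs →
             filter P? (map f xs) ≡ map f (filter (P? ∘ f) xs)
filter-map P? f [] = refl
filter-map P? f (x ∷ xs) with does (P? (f x))
... | true  = cong (f x ∷_) (filter-map P? f xs)
... | false = filter-map P? f xs

deduplicate-cong : ∀ {A : Set} {R R′ : A → A → Set}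
                   (R? : ∀ x y → Dec (R x y)) (R′? : ∀ x y → Dec (R′ x y)) →
                   (∀ x y → R x y ⇔ R′ x y) → ∀ xs → deduplicate R? xs ≡ deduplicate R′? xs
deduplicate-cong R? R′? R⇔R′ [] = refl
deduplicate-cong R? R′? R⇔R′ (x ∷ xs) rewrite deduplicate-cong R? R′? R⇔R′ xs =
  cong (x ∷_) (filter-≐ (¬? ∘ R? x) (¬? ∘ R′? x)
                        ((λ ¬R R′ → ¬R (from (R⇔R′ x _) R′)) , (λ ¬R′ R → ¬R′ (to (R⇔R′ x _) R)))
                        (deduplicate R′? xs))

module _ {A B : Set} (_≟ᴮ_ : DecidableEquality B) where

  deduplicate-map : (f : A → B) (xs : List A) →
                    deduplicate _≟ᴮ_ (map f xs) ≡ map f (deduplicate (λ x y → f x ≟ᴮ f y) xs)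
  deduplicate-map f [] = refl
  deduplicate-map f (x ∷ xs) rewrite deduplicate-map f xs =
    cong (f x ∷_) (filter-map (¬? ∘ (f x ≟ᴮ_)) f (deduplicate (λ x y → f x ≟ᴮ f y) xs))

  length-deduplicate-map-cong : ∀ (f g : A → B) → (∀ x y → f x ≡ f y ⇔ g x ≡ g y) → ∀ xs →
    length (deduplicate _≟ᴮ_ (map f xs)) ≡ length (deduplicate _≟ᴮ_ (map g xs))
  length-deduplicate-map-cong f g same-ker xs = begin
    length (deduplicate _≟ᴮ_ (map f xs))    ≡⟨ cong length (deduplicate-map f xs) ⟩
    length (map f (deduplicate f-ker? xs))  ≡⟨ length-map f (deduplicate f-ker? xs) ⟩
    length (deduplicate f-ker? xs)          ≡⟨ cong length (deduplicate-cong f-ker? g-ker? same-ker xs) ⟩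
    length (deduplicate g-ker? xs)          ≡⟨ length-map g (deduplicate g-ker? xs) ⟨
    length (map g (deduplicate g-ker? xs))  ≡⟨ cong length (deduplicate-map g xs) ⟨
    length (deduplicate _≟ᴮ_ (map g xs))    ∎
    where
    open ≡-Reasoning
    f-ker? = λ x y → f x ≟ᴮ f y
    g-ker? = λ x y → g x ≟ᴮ g y

∈-toList⇒lookup : ∀ {x : Vec ℚ n} {z} → z ∈ₗ toList x → ∃ λ j → lookup x j ≡ z
∈-toList⇒lookup z∈ = let z∈x = ∈-toList⁻ z∈ in index z∈x , sym (lookup-index z∈x)

valuesOn : Vec ℚ n → Subset n → List ℚ
valuesOn x I = map (lookup x) (members I)

distinctOn : Vec ℚ n → Subset n → ℕ
distinctOn x I = length (deduplicate _≟_ (valuesOn x I))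

distinctOn-cong : ∀ (x y : Vec ℚ n) I → (∀ i j → lookup x i ≡ lookup x j ⇔ lookup y i ≡ lookup y j) →
                  distinctOn x I ≡ distinctOn y I
distinctOn-cong x y I same-ker = length-deduplicate-map-cong _≟_ (lookup x) (lookup y) same-ker (members I)

distinctOn-pos : ∀ (x : Vec ℚ n) {I} → Nonempty I → 1 ≤ distinctOn x I
distinctOn-pos x {I} (i , i∈I) with valuesOn x I | ∈-map⁺ (lookup x) (∈-members⁺ i∈I)
... | _ ∷ _ | _ = s≤s z≤n

module _ {x : Vec ℚ n} {I : Subset n} (I↑ : Below I (∁ I) x) where

  private
    smaller : ℚ → List ℚ
    smaller v = filter (_<? v) (toList x)

  rank<distinctOn : ∀ {i} → i ∈ I → rank x i ℕ.< distinctOn x I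
  rank<distinctOn {i} i∈I =
    length-deduplicate-mono-< _≟_ smaller⊆values (∈-map⁺ (lookup x) (∈-members⁺ i∈I))
      (λ xᵢ∈ → <-irrefl refl (proj₂ (∈-filter⁻ (_<? lookup x i) {xs = toList x} xᵢ∈)))
    where
    smaller⊆values : smaller (lookup x i) ⊆ₗ valuesOn x I
    smaller⊆values z∈ with ∈-filter⁻ (_<? lookup x i) {xs = toList x} z∈
    ... | z∈x , z<xᵢ with ∈-toList⇒lookup z∈x
    ... | j , refl with j ∈? I
    ... | yes j∈I = ∈-map⁺ (lookup x) (∈-members⁺ j∈I)
    ... | no j∉I  = contradiction (separates I↑ i∈I (x∉p⇒x∈∁p j∉I)) (<-asym z<xᵢ)

  distinctOn≤rank : ∀ {j} → j ∉ I → distinctOn x I ≤ rank x j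
  distinctOn≤rank {j} j∉I = length-deduplicate-mono _≟_ values⊆smaller
    where
    values⊆smaller : valuesOn x I ⊆ₗ smaller (lookup x j)
    values⊆smaller z∈ with ∈-map⁻ (lookup x) z∈
    ... | i , i∈ , refl =
      ∈-filter⁺ (_<? lookup x j) (∈-toList⁺ (∈-lookup i x)) (separates I↑ (∈-members⁻ i∈) (x∉p⇒x∈∁p j∉I))

  I[distinctOn]≡ : I[ distinctOn x I ] x ≡ I
  I[distinctOn]≡ = trans (tabulate-cong pointwise) (tabulate∘lookup I)
    where
    outside≢inside : outside ≢ inside
    outside≢inside ()
    pointwise : ∀ i → ⌊ rank x i ℕ.<? distinctOn x I ⌋ ≡ lookup I i
    pointwise i rewrite isYes≗does (rank x i ℕ.<? distinctOn x I) with lookup I i in Iᵢ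
    ... | inside  = dec-true (rank x i ℕ.<? _) (rank<distinctOn (lookup⇒[]= i I Iᵢ))
    ... | outside = dec-false (rank x i ℕ.<? _) λ rank<m →
      ℕ.<-irrefl refl (ℕ.<-≤-trans rank<m (distinctOn≤rank (outside≢inside ∘ trans (sym Iᵢ) ∘ []=⇒lookup)))

-- The common kernel of S′ and its closure properties

comp₂-applyOp : ∀ {k n} (g : Op n) (ts : Fin n → Tup k) c →
                comp₂ (applyOp g ts) c ≡ tabulate (λ i → g (tabulate (λ j → lookup (comp₂ (ts j) c) i)))
comp₂-applyOp g ts zero    = refl
comp₂-applyOp g ts (suc _) = refl

entry-applyOp : ∀ {k n} (g : Op n) (ts : Fin n → Tup k) c i →
                entry (applyOp g ts) (c , i) ≡ g (tabulate (λ j → entry (ts j) (c , i)))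
entry-applyOp g ts c i = trans (cong (λ v → lookup v i) (comp₂-applyOp g ts c)) (lookup∘tabulate _ i)

translate : ∀ {k} → ℚ → Tup k → Tup k
translate c t = applyOp {n = 1} (λ xs → head xs + c) (λ _ → t)

entry-translate : ∀ {k} c (t : Tup k) d i → entry (translate c t) (d , i) ≡ entry t (d , i) + c
entry-translate c t = entry-applyOp {n = 1} (λ xs → head xs + c) (λ _ → t)

module Closure {lex : ℚ → ℚ → ℚ} (isLex : IsLex lex) {k : ℕ} {S : Rel k} (smooth : Smooth S) where

  CommonKer : Fin k → Fin k → Set
  CommonKer i j = ∀ s → S s → InKer s (zero , i) (zero , j)

  S-column-move : ∀ c d {s} → S s → ∃ λ s̃ → S s̃ × comp₂ s̃ d ≡ comp₂ s c
  S-column-move zero    zero    Ss = _ , Ss , refl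
  S-column-move (suc _) (suc _) Ss = _ , Ss , refl
  S-column-move zero    (suc _) Ss = to   (proj₂ smooth _) (_ , Ss , refl)
  S-column-move (suc _) zero    Ss = from (proj₂ smooth _) (_ , Ss , refl)

  LexClo-column-move : ∀ c d {t} → LexClo lex S t → ∃ λ t̃ → LexClo lex S t̃ × comp₂ t̃ d ≡ comp₂ t c
  LexClo-column-move c d (inS St) with S-column-move c d St
  ... | s̃ , Ss̃ , eq = s̃ , inS Ss̃ , eq
  LexClo-column-move c d (app {g = g} G ts ts∈) =
    applyOp g ts̃ , app G ts̃ (proj₁ ∘ proj₂ ∘ moved) ,
    trans (comp₂-applyOp g ts̃ d)
      (trans (tabulate-cong λ i → cong g (tabulate-cong λ j → cong (λ v → lookup v i) (proj₂ (proj₂ (moved j)))))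
        (sym (comp₂-applyOp g ts c)))
    where
    moved = λ j → LexClo-column-move c d (ts∈ j)
    ts̃ = proj₁ ∘ moved

  CommonKer-any-column : ∀ c {i j} → (∀ s → S s → InKer s (c , i) (c , j)) ⇔ CommonKer i j
  CommonKer-any-column c {i} {j} = mk⇔ (move zero c) (move c zero)
    where
    move : ∀ c d → (∀ s → S s → InKer s (d , i) (d , j)) → ∀ s → S s → InKer s (c , i) (c , j)
    move c d kerᵈ s Ss with S-column-move c d Ss
    ... | s̃ , Ss̃ , eq = subst₂ _≡_ (cong (λ v → lookup v i) eq) (cong (λ v → lookup v j) eq) (kerᵈ s̃ Ss̃)

  S′-ker : ∀ {t} → S′ lex S t → ∀ c i j → (lookup (comp₂ t c) i ≡ lookup (comp₂ t c) j) ⇔ CommonKer i j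
  S′-ker (_ , ker) c i j = ⇔-trans (ker (c , i) (c , j)) (CommonKer-any-column c)

  LexClo-InKer : ∀ {t} → LexClo lex S t → ∀ p p′ → (∀ s → S s → InKer s p p′) → InKer t p p′
  LexClo-InKer (inS St) p p′ ker = ker _ St
  LexClo-InKer (app {g = g} G ts ts∈) (c , i) (c′ , i′) ker =
    trans (entry-applyOp g ts c i)
      (trans (cong g (tabulate-cong λ j → LexClo-InKer (ts∈ j) (c , i) (c′ , i′) ker))
        (sym (entry-applyOp g ts c′ i′)))

  lexT : Tup k → Tup k → Tup k
  lexT s t = applyOp (bin→Op lex) (lookup (s ∷ t ∷ []))

  entry-lexT : ∀ s t c i → entry (lexT s t) (c , i) ≡ lex (entry s (c , i)) (entry t (c , i))
  entry-lexT s t = entry-applyOp (bin→Op lex) (lookup (s ∷ t ∷ []))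

  lexT-S′ : ∀ {s t} → LexClo lex S s → S′ lex S t → S′ lex S (lexT s t)
  lexT-S′ {s} {t} s∈ (t∈ , ker) = app base (lookup (s ∷ t ∷ [])) (λ { zero → s∈ ; (suc zero) → t∈ }) , ker′
    where
    open Lex isLex
    ker′ : ∀ p p′ → InKer (lexT s t) p p′ ⇔ (∀ s → S s → InKer s p p′)
    ker′ p@(c , i) p′@(c′ , i′) = mk⇔
      (λ eq → to (ker p p′)
                 (proj₂ (injective (trans (sym (entry-lexT s t c i)) (trans eq (entry-lexT s t c′ i′))))))
      (λ common → trans (entry-lexT s t c i)
                    (trans (cong₂ lex (LexClo-InKer s∈ p p′ common) (from (ker p p′) common))
                      (sym (entry-lexT s t c′ i′))))

  translate-S′ : ∀ c {t} → S′ lex S t → S′ lex S (translate c t)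
  translate-S′ c {t} (t∈ , ker) = app (aut (_+ c) (+-isAut c)) (λ _ → t) (λ _ → t∈) , ker′
    where
    ker′ : ∀ p p′ → InKer (translate c t) p p′ ⇔ (∀ s → S s → InKer s p p′)
    ker′ p@(d , i) p′@(d′ , i′) = mk⇔
      (λ eq → to (ker p p′)
                 (∙-cancelʳ c _ _ (trans (sym (entry-translate c t d i)) (trans eq (entry-translate c t d′ i′)))))
      (λ common → trans (entry-translate c t d i)
                    (trans (cong (_+ c) (from (ker p p′) common)) (sym (entry-translate c t d′ i′))))

  copy-column-at-threshold :
    ∀ q a b {p P Rem} → S′ lex S p → Nonempty P → Below P Rem (comp₂ p a) →
    ∃ λ T → S′ lex S T × AtMostOn q (comp₂ T b) P × AboveOn q (comp₂ T b) Rem ×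
            SimOn P (comp₂ T b) (comp₂ p a)
  copy-column-at-threshold q a b {p} {P} {Rem} p∈ P≢∅ P↑Rem =
    T , translate-S′ shift (lexT-S′ p̃∈ p∈) , T≤q , q<T , T∼p
    where
    open Lex isLex
    moved = LexClo-column-move a b (proj₁ p∈)
    p̃  = proj₁ moved
    p̃∈ = proj₁ (proj₂ moved)

    w : Fin k → ℚ
    w i = entry (lexT p̃ p) (b , i)

    w≡ : ∀ i → w i ≡ lex (entry p (a , i)) (entry p (b , i))
    w≡ i = trans (entry-lexT p̃ p b i) (cong (λ v → lex (lookup v i) (entry p (b , i))) (proj₂ (proj₂ moved)))

    w-< : ∀ {i j} → entry p (a , i) < entry p (a , j) → w i < w j
    w-< {i} {j} lt = subst₂ _<_ (sym (w≡ i)) (sym (w≡ j)) (<₁ lt)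

    w∼p : ∀ i j → (w i ℚ.≤ w j) ⇔ (entry p (a , i) ℚ.≤ entry p (a , j))
    w∼p i j = subst₂ (λ u v → (u ℚ.≤ v) ⇔ (entry p (a , i) ℚ.≤ entry p (a , j))) (sym (w≡ i)) (sym (w≡ j))
                (≤⇔≤₁ (λ eq → from (S′-ker p∈ b i j) (to (S′-ker p∈ a i j) eq)))

    maximum = argmaxOn w P P≢∅
    m = proj₁ maximum

    -- moves the largest value of w on P exactly to q
    shift : ℚ
    shift = q - w m

    T = translate shift (lexT p̃ p)

    T≡ : ∀ i → entry T (b , i) ≡ w i + shift
    T≡ = entry-translate shift (lexT p̃ p) b

    w[m]+shift≡q : w m + shift ≡ q
    w[m]+shift≡q = trans (+-comm (w m) shift) (//-rightDividesˡ (w m) q)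

    T≤q : AtMostOn q (comp₂ T b) P
    T≤q {i} i∈P = subst₂ ℚ._≤_ (sym (T≡ i)) w[m]+shift≡q (+-monoˡ-≤ shift (proj₂ (proj₂ maximum) i∈P))

    q<T : AboveOn q (comp₂ T b) Rem
    q<T {j} j∈Rem = subst₂ _<_ w[m]+shift≡q (sym (T≡ j))
                      (+-monoˡ-< shift (w-< (separates P↑Rem (proj₁ (proj₂ maximum)) j∈Rem)))

    T∼p : SimOn P (comp₂ T b) (comp₂ p a)
    T∼p i j _ _ =
      ⇔-trans (subst₂ (λ u v → (u ℚ.≤ v) ⇔ (w i ℚ.≤ w j)) (sym (T≡ i)) (sym (T≡ j)) (+-≤⇔ shift)) (w∼p i j)

-- Chains of ℓℓ_q

module Chains {lex : ℚ → ℚ → ℚ} (isLex : IsLex lex) {k : ℕ} {S : Rel k} (smooth : Smooth S)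
              {q : ℚ} {f : ℚ → ℚ → ℚ} (isLL : IsLL q f) where

  open Closure isLex smooth
  open LL isLL

  chain : Vec (Tup k) n → Tup k → Tup k
  chain Cs t = iterT f (Cs ∷ʳ t)

  column-chain-∷ : ∀ C (Cs : Vec (Tup k) n) t c →
                   comp₂ (chain (C ∷ Cs) t) c ≡ zipWith f (comp₂ C c) (comp₂ (chain Cs t) c)
  column-chain-∷ C []      t zero    = refl
  column-chain-∷ C []      t (suc _) = refl
  column-chain-∷ C (_ ∷ _) t zero    = refl
  column-chain-∷ C (_ ∷ _) t (suc _) = refl

  lookup-chain-∷ : ∀ C (Cs : Vec (Tup k) n) t c i →
                   lookup (comp₂ (chain (C ∷ Cs) t) c) i ≡
                   f (lookup (comp₂ C c) i) (lookup (comp₂ (chain Cs t) c) i)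
  lookup-chain-∷ C Cs t c i = trans (cong (λ v → lookup v i) (column-chain-∷ C Cs t c))
                                    (lookup-zipWith f i (comp₂ C c) (comp₂ (chain Cs t) c))

  chain-ker : ∀ {Cs : Vec (Tup k) n} {t} → All (S′ lex S) Cs → S′ lex S t → ∀ c i j →
              (lookup (comp₂ (chain Cs t) c) i ≡ lookup (comp₂ (chain Cs t) c) j) ⇔ CommonKer i j
  chain-ker [] t∈ = S′-ker t∈
  chain-ker {Cs = C ∷ Cs} {t} (C∈ ∷ Cs∈) t∈ c i j = mk⇔
    (λ eq → to (S′-ker C∈ c i j)
               (proj₁ (injective (trans (sym (lookup-chain-∷ C Cs t c i))
                                        (trans eq (lookup-chain-∷ C Cs t c j))))))
    (λ common → trans (lookup-chain-∷ C Cs t c i)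
                  (trans (cong₂ f (from (S′-ker C∈ c i j) common) (from (chain-ker Cs∈ t∈ c i j) common))
                    (sym (lookup-chain-∷ C Cs t c j))))

  module Link {C : Tup k} {Cs : Vec (Tup k) n} {t : Tup k}
              (C∈ : S′ lex S C) (Cs∈ : All (S′ lex S) Cs) (t∈ : S′ lex S t) (c : Fin 2) where

    private
      x = comp₂ C c
      z = comp₂ (chain Cs t) c
      y = comp₂ (chain (C ∷ Cs) t) c

      y≡ : ∀ i → lookup y i ≡ f (lookup x i) (lookup z i)
      y≡ = lookup-chain-∷ C Cs t c

      x⇔z : ∀ i j → lookup x i ≡ lookup x j ⇔ lookup z i ≡ lookup z j
      x⇔z i j = ⇔-trans (S′-ker C∈ c i j) (⇔-sym (chain-ker Cs∈ t∈ c i j))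

    below-split : ∀ {A B} → AtMostOn q x A → AboveOn q x B → Below A B y
    below-split x≤q q<x = mkBelow λ {i} {j} i∈ j∈ →
      subst₂ _<_ (sym (y≡ i)) (sym (y≡ j)) (<-low-high (x≤q i∈) (q<x j∈))

    below-high : ∀ {A B} → AboveOn q x A → AboveOn q x B → Below A B z → Below A B y
    below-high q<xᴬ q<xᴮ A↑B = mkBelow λ {i} {j} i∈ j∈ →
      subst₂ _<_ (sym (y≡ i)) (sym (y≡ j)) (<-high (q<xᴬ i∈) (q<xᴮ j∈) (separates A↑B i∈ j∈))

    sim-low : ∀ {A} → AtMostOn q x A → SimOn A y x
    sim-low x≤q i j i∈ j∈ =
      subst₂ (λ u v → (u ℚ.≤ v) ⇔ (lookup x i ℚ.≤ lookup x j)) (sym (y≡ i)) (sym (y≡ j))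
             (≤⇔≤-low (x≤q i∈) (x≤q j∈) (to (x⇔z i j)))

    sim-high : ∀ {A} → AboveOn q x A → SimOn A y z
    sim-high q<x i j i∈ j∈ =
      subst₂ (λ u v → (u ℚ.≤ v) ⇔ (lookup z i ℚ.≤ lookup z j)) (sym (y≡ i)) (sym (y≡ j))
             (≤⇔≤-high (q<x i∈) (q<x j∈) (from (x⇔z i j)))

  record Separated (I O : Subset k) (Cs : Vec (Tup k) n) : Set where
    field
      below         : ∀ {t} → S′ lex S t → ∀ c → Below I O (comp₂ (chain Cs t) c)
      agree-outside : ∀ {t} → S′ lex S t → ∀ c → SimOn O (comp₂ (chain Cs t) c) (comp₂ t c)
      agree-inside  : ∀ {t} → S′ lex S t → ∀ c c′ → SimOn I (comp₂ (chain Cs t) c) (comp₂ (chain Cs t) c′)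

  Separated-⊆ : ∀ {I O O′} {Cs : Vec (Tup k) n} → O′ ⊆ O → Separated I O Cs → Separated I O′ Cs
  Separated-⊆ {Cs = Cs} O′⊆O sep = record
    { below         = λ t∈ c → Below-⊆ʳ O′⊆O (below t∈ c)
    ; agree-outside = λ {t} t∈ c → SimOn-⊆ (comp₂ (chain Cs t) c) (comp₂ t c) O′⊆O (agree-outside t∈ c)
    ; agree-inside  = agree-inside
    }
    where open Separated sep

  separated-∅ : ∀ {T O} → S′ lex S T → (∀ c → AboveOn q (comp₂ T c) O) → Separated ∅ O (T ∷ [])
  separated-∅ T∈ q<T = record
    { below         = λ _ _ → mkBelow λ i∈∅ _ → contradiction i∈∅ ∉⊥
    ; agree-outside = λ t∈ c → Link.sim-high T∈ [] t∈ c (q<T c)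
    ; agree-inside  = λ _ _ _ _ _ i∈∅ → contradiction i∈∅ ∉⊥
    }

  SeparatingChainOn : Subset k → Subset k → Tup k → Set
  SeparatingChainOn P Rem p =
    ∃₂ λ n (Ts : Vec (Tup k) n) → All (S′ lex S) Ts × ∃ λ I → I ⊆ Rem × Separated (P ∪ I) (Rem ─ I) (p ∷ Ts)

  module Extend (a : Fin 2) {P Rem : Subset k} {p T : Tup k} (p∈ : S′ lex S p) (T∈ : S′ lex S T)
                (pᵃ≤q : AtMostOn q (comp₂ p a) P) (q<p : ∀ c → AboveOn q (comp₂ p c) Rem)
                (q<pᵇ : AboveOn q (comp₂ p (opposite a)) P)
                (Tᵇ≤q : AtMostOn q (comp₂ T (opposite a)) P) (q<Tᵇ : AboveOn q (comp₂ T (opposite a)) Rem)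
                (Tᵇ∼pᵃ : SimOn P (comp₂ T (opposite a)) (comp₂ p a)) where

    private b = opposite a

    extend : ∀ {Ts : Vec (Tup k) n} {I O} → All (S′ lex S) Ts → I ⊆ Rem → O ⊆ Rem →
             Separated I O (T ∷ Ts) → Separated (P ∪ I) O (p ∷ T ∷ Ts)
    extend {Ts = Ts} {I} {O} Ts∈ I⊆Rem O⊆Rem sep = record
      { below         = λ t∈ → both-columns a (belowᵃ t∈) (belowᵇ t∈)
      ; agree-outside = outside-agrees
      ; agree-inside  = λ {t} t∈ → SimOn-all-columns (Y t) a (insideᵃᵇ t∈)
      }
      where
      open Separated sep
      module Outer {t} (t∈ : S′ lex S t) = Link p∈ (T∈ ∷ Ts∈) t∈
      module Inner {t} (t∈ : S′ lex S t) = Link T∈ Ts∈ t∈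

      Y Z : Tup k → Fin 2 → Vec ℚ k
      Y t = comp₂ (chain (p ∷ T ∷ Ts) t)
      Z t = comp₂ (chain (T ∷ Ts) t)

      belowᵃ : ∀ {t} → S′ lex S t → Below (P ∪ I) O (Y t a)
      belowᵃ t∈ = Below-∪ˡ (Outer.below-split t∈ a pᵃ≤q (q<p a ∘ O⊆Rem))
                           (Outer.below-high t∈ a (q<p a ∘ I⊆Rem) (q<p a ∘ O⊆Rem) (below t∈ a))

      belowᵇ : ∀ {t} → S′ lex S t → Below (P ∪ I) O (Y t b)
      belowᵇ t∈ = Outer.below-high t∈ b (Lift-∪ q<pᵇ (q<p b ∘ I⊆Rem)) (q<p b ∘ O⊆Rem)
                    (Below-∪ˡ (Inner.below-split t∈ b Tᵇ≤q (q<Tᵇ ∘ O⊆Rem)) (below t∈ b))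

      outside-agrees : ∀ {t} → S′ lex S t → ∀ c → SimOn O (Y t c) (comp₂ t c)
      outside-agrees {t} t∈ c = begin
        Y t c      ≈⟨ Outer.sim-high t∈ c (q<p c ∘ O⊆Rem) ⟩
        Z t c      ≈⟨ agree-outside t∈ c ⟩
        comp₂ t c  ∎
        where open SimOn-Reasoning O

      insideᵃᵇ : ∀ {t} → S′ lex S t → SimOn (P ∪ I) (Y t a) (Y t b)
      insideᵃᵇ {t} t∈ = SimOn-∪ (Y t a) (Y t b) onP onI
        (Outer.below-split t∈ a pᵃ≤q (q<p a ∘ I⊆Rem))
        (Outer.below-high t∈ b q<pᵇ (q<p b ∘ I⊆Rem) (Inner.below-split t∈ b Tᵇ≤q (q<Tᵇ ∘ I⊆Rem)))
        where
        onP : SimOn P (Y t a) (Y t b)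
        onP = begin
          Y t a      ≈⟨ Outer.sim-low t∈ a pᵃ≤q ⟩
          comp₂ p a  ≈⟨ Tᵇ∼pᵃ ⟨
          comp₂ T b  ≈⟨ Inner.sim-low t∈ b Tᵇ≤q ⟨
          Z t b      ≈⟨ Outer.sim-high t∈ b q<pᵇ ⟨
          Y t b      ∎
          where open SimOn-Reasoning P
        onI : SimOn I (Y t a) (Y t b)
        onI = begin
          Y t a      ≈⟨ Outer.sim-high t∈ a (q<p a ∘ I⊆Rem) ⟩
          Z t a      ≈⟨ agree-inside t∈ a b ⟩
          Z t b      ≈⟨ Outer.sim-high t∈ b (q<p b ∘ I⊆Rem) ⟨
          Y t b      ∎
          where open SimOn-Reasoning I

    stop : AboveOn q (comp₂ T a) Rem → SeparatingChainOn P Rem p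
    stop q<Tᵃ = 1 , T ∷ [] , T∈ ∷ [] , ∅ , ⊥⊆ ,
      extend [] ⊥⊆ (p─q⊆p Rem ∅) (separated-∅ T∈ (both-columns a (q<Tᵃ ∘ p─q⊆p Rem ∅) (q<Tᵇ ∘ p─q⊆p Rem ∅)))

    descend : ∀ L → SeparatingChainOn (Rem ∩ L) (Rem ─ L) T → SeparatingChainOn P Rem p
    descend L (n , Ts , Ts∈ , I , I⊆Rem─L , sep) =
      suc n , T ∷ Ts , T∈ ∷ Ts∈ , U ∪ I , U∪I⊆Rem ,
      extend Ts∈ U∪I⊆Rem (p─q⊆p Rem (U ∪ I)) (Separated-⊆ O⊆O′ sep)
      where
      U = Rem ∩ L
      U∪I⊆Rem : U ∪ I ⊆ Rem
      U∪I⊆Rem = Lift-∪ (p∩q⊆p Rem L) (p─q⊆p Rem L ∘ I⊆Rem─L)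
      O⊆O′ : Rem ─ (U ∪ I) ⊆ (Rem ─ L) ─ I
      O⊆O′ i∈ = x∈p∧x∉q⇒x∈p─q (x∈p∧x∉q⇒x∈p─q i∈Rem (i∉U∪I ∘ x∈p∪q⁺ ∘ inj₁ ∘ x∈p∩q⁺ ∘ (i∈Rem ,_)))
                              (i∉U∪I ∘ x∈p∪q⁺ ∘ inj₂)
        where
        i∈Rem = p─q⊆p Rem (U ∪ I) i∈
        i∉U∪I = x∈p─q⇒x∉q i∈

  separating-chain :
    ∀ a fuel {P Rem p} → ∣ Rem ∣ ℕ.< fuel → S′ lex S p → Nonempty P →
    AtMostOn q (comp₂ p a) P → (∀ c → AboveOn q (comp₂ p c) Rem) → AboveOn q (comp₂ p (opposite a)) P →
    SeparatingChainOn P Rem p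
  separating-chain a (suc fuel) {P} {Rem} {p} ∣Rem∣<fuel p∈ P≢∅ pᵃ≤q q<p q<pᵇ =
    next (copy-column-at-threshold q a (opposite a) p∈ P≢∅ (mkBelow λ i∈ j∈ → ≤-<-trans (pᵃ≤q i∈) (q<p a j∈)))
    where
    next : (∃ λ T → S′ lex S T × AtMostOn q (comp₂ T (opposite a)) P × AboveOn q (comp₂ T (opposite a)) Rem ×
                    SimOn P (comp₂ T (opposite a)) (comp₂ p a)) →
           SeparatingChainOn P Rem p
    next (T , T∈ , Tᵇ≤q , q<Tᵇ , Tᵇ∼pᵃ) with nonempty? (Rem ∩ atMost q (comp₂ T a))
    ... | no U≡∅ = stop λ {i} i∈ → ≰⇒> (λ Tᵃ≤q → U≡∅ (i , x∈p∩q⁺ (i∈ , from (∈-atMost⇔ (comp₂ T a) i) Tᵃ≤q)))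
      where open Extend a p∈ T∈ pᵃ≤q q<p q<pᵇ Tᵇ≤q q<Tᵇ Tᵇ∼pᵃ
    ... | yes U≢∅ =
      descend Low (separating-chain a fuel ∣Rem─Low∣<fuel T∈ U≢∅ Tᵃ≤q q<T (q<Tᵇ ∘ p∩q⊆p Rem Low))
      where
      open Extend a p∈ T∈ pᵃ≤q q<p q<pᵇ Tᵇ≤q q<Tᵇ Tᵇ∼pᵃ
      Low = atMost q (comp₂ T a)
      ∣Rem─Low∣<fuel = ℕ.<-≤-trans (p∩q≢∅⇒∣p─q∣<∣p∣ Rem Low U≢∅) (ℕ.s≤s⁻¹ ∣Rem∣<fuel)
      Tᵃ≤q : AtMostOn q (comp₂ T a) (Rem ∩ Low)
      Tᵃ≤q {i} i∈ = to (∈-atMost⇔ (comp₂ T a) i) (p∩q⊆q Rem Low i∈)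
      q<T : ∀ c → AboveOn q (comp₂ T c) (Rem ─ Low)
      q<T = both-columns a (λ {i} i∈ → ≰⇒> (x∈p─q⇒x∉q i∈ ∘ from (∈-atMost⇔ (comp₂ T a) i)))
                           (q<Tᵇ ∘ p─q⊆p Rem Low)

-- The separating chain for a min-clean first link

module Construction {lex : ℚ → ℚ → ℚ} (isLex : IsLex lex) {k : ℕ} {S : Rel k} (smooth : Smooth S)
                    {ll : ℚ → ℚ → ℚ → ℚ} (isLL : ∀ q → IsLL q (ll q)) where

  open Closure isLex smooth
  module C q = Chains isLex smooth (isLL q)
  open C using (Separated)

  SeparatingChain : ℚ → Tup k → Set
  SeparatingChain q r =
    ∃ λ I → Nonempty I × ∃₂ λ n (Ts : Vec (Tup k) n) → All (S′ lex S) Ts × Separated q I (∁ I) (r ∷ Ts)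

  single-minimal-column : ∀ a {r} → S′ lex S r → ∀ i₀ →
                          (∀ i → lookup (comp₂ r a) i₀ ℚ.≤ lookup (comp₂ r a) i) →
                          (∀ i → lookup (comp₂ r a) i₀ < lookup (comp₂ r (opposite a)) i) →
                          SeparatingChain (lookup (comp₂ r a) i₀) r
  single-minimal-column a {r} r∈ i₀ a-min b-above =
    finish (C.separating-chain μ a (suc k) (s≤s (∣p∣≤n (∁ J))) r∈ (i₀ , i₀∈J)
             (to (∈-atMost⇔ (comp₂ r a) _)) μ<r (λ {i} _ → b-above i))
    where
    μ = lookup (comp₂ r a) i₀
    J = atMost μ (comp₂ r a)
    i₀∈J = from (∈-atMost⇔ (comp₂ r a) i₀) ≤-refl
    μ<r : ∀ c → AboveOn μ (comp₂ r c) (∁ J)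
    μ<r = both-columns a (λ {i} i∈ → ≰⇒> (x∈∁p⇒x∉p i∈ ∘ from (∈-atMost⇔ (comp₂ r a) i))) (λ {i} _ → b-above i)
    finish : C.SeparatingChainOn μ J (∁ J) r → SeparatingChain μ r
    finish (n , Ts , Ts∈ , I , _ , sep) =
      J ∪ I , (i₀ , x∈p∪q⁺ (inj₁ i₀∈J)) , n , Ts , Ts∈ , C.Separated-⊆ μ ∁J∪I⊆ sep
      where
      ∁J∪I⊆ : ∁ (J ∪ I) ⊆ ∁ J ─ I
      ∁J∪I⊆ i∈ = x∈p∧x∉q⇒x∈p─q (x∉p⇒x∈∁p (x∈∁p⇒x∉p i∈ ∘ x∈p∪q⁺ ∘ inj₁)) (x∈∁p⇒x∉p i∈ ∘ x∈p∪q⁺ ∘ inj₂)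

  both-columns-minimal : ∀ {r} → S′ lex S r → ∀ {μ} J → Nonempty J →
                         (∀ c i → i ∈ J ⇔ lookup (comp₂ r c) i ℚ.≤ μ) → (∀ c i → μ ℚ.≤ lookup (comp₂ r c) i) →
                         SeparatingChain μ r
  both-columns-minimal {r} r∈ {μ} J J≢∅ J⇔ μ-min = J , J≢∅ , 0 , [] , [] , record
    { below         = λ t∈ c → Link.below-split t∈ c (to (J⇔ c _)) (μ<r c)
    ; agree-outside = λ t∈ c → Link.sim-high t∈ c (μ<r c)
    ; agree-inside  = columns-agree
    }
    where
    open C μ using (chain)
    module Link {t} (t∈ : S′ lex S t) = C.Link μ r∈ [] t∈

    μ<r : ∀ c → AboveOn μ (comp₂ r c) (∁ J)
    μ<r c {i} i∈ = ≰⇒> (x∈∁p⇒x∉p i∈ ∘ from (J⇔ c i))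

    r≡μ : ∀ c → Lift (λ i → lookup (comp₂ r c) i ≡ μ) J
    r≡μ c {i} i∈ = ≤-antisym (to (J⇔ c i) i∈) (μ-min c i)

    columns-agree : ∀ {t} → S′ lex S t → ∀ c c′ →
                    SimOn J (comp₂ (chain (r ∷ []) t) c) (comp₂ (chain (r ∷ []) t) c′)
    columns-agree {t} t∈ c c′ = begin
      comp₂ (chain (r ∷ []) t) c   ≈⟨ Link.sim-low t∈ c (to (J⇔ c _)) ⟩
      comp₂ r c                    ≈⟨ SimOn-const (comp₂ r c) (comp₂ r c′) (r≡μ c) (r≡μ c′) ⟩
      comp₂ r c′                   ≈⟨ Link.sim-low t∈ c′ (to (J⇔ c′ _)) ⟨
      comp₂ (chain (r ∷ []) t) c′  ∎
      where open SimOn-Reasoning J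

  separating-chain-from : ∀ {t₁} → S′ lex S t₁ → MinClean t₁ → Fin k → ∃ λ q → SeparatingChain q t₁
  separating-chain-from {t₁@(u , v)} t₁∈ clean i with argmin-lookup u i | argmin-lookup v i
  ... | i₀ , u-min | i₁ , v-min with <-cmp (lookup u i₀) (lookup v i₁)
  ... | tri< μᵘ<μᵛ _ _ = _ , single-minimal-column zero t₁∈ i₀ u-min (λ j → <-≤-trans μᵘ<μᵛ (v-min j))
  ... | tri> _ _ μᵛ<μᵘ = _ , single-minimal-column (suc zero) t₁∈ i₁ v-min (λ j → <-≤-trans μᵛ<μᵘ (u-min j))
  ... | tri≈ _ μᵘ≡μᵛ _ = _ , both-columns-minimal t₁∈ J (i₀ , from (∈-atMost⇔ u i₀) ≤-refl) J⇔ μ-min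
    where
    μ = lookup u i₀
    J = atMost μ u
    μ-min : ∀ c i → μ ℚ.≤ lookup (comp₂ t₁ c) i
    μ-min zero       = u-min
    μ-min (suc zero) = subst (λ m → ∀ i → m ℚ.≤ lookup v i) (sym μᵘ≡μᵛ) v-min
    same-minx : ∀ i → InMinx u i ⇔ InMinx v i
    same-minx = clean zero (suc zero) (i₀ , λ (c , j) → μ-min c j)
                                      (i₁ , λ (c , j) → subst (ℚ._≤ entry t₁ (c , j)) μᵘ≡μᵛ (μ-min c j))
    J⇔ : ∀ c i → i ∈ J ⇔ lookup (comp₂ t₁ c) i ℚ.≤ μ
    J⇔ zero       i = ∈-atMost⇔ u i
    J⇔ (suc zero) i = begin
      i ∈ J                       ≈⟨ ∈-atMost⇔ u i ⟩
      lookup u i ℚ.≤ μ            ≈⟨ InMinx⇔≤min u u-min i ⟨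
      InMinx u i                  ≈⟨ same-minx i ⟩
      InMinx v i                  ≈⟨ InMinx⇔≤min v v-min i ⟩
      lookup v i ℚ.≤ lookup v i₁  ≡⟨ cong (lookup v i ℚ.≤_) μᵘ≡μᵛ ⟨
      lookup v i ℚ.≤ μ            ∎
      where open Relation.Binary.Reasoning.Setoid (⇔-setoid Level.zero)

  conclude : ∀ {q r n} {Ts : Vec (Tup k) n} {I} → S′ lex S r → All (S′ lex S) Ts → Nonempty I →
             Separated q I (∁ I) (r ∷ Ts) →
             Σ ℕ λ m → 1 ≤ m × (∀ t → S′ lex S t →
               let t′ = C.chain q (r ∷ Ts) t ; u′ = proj₁ t′ ; v′ = proj₂ t′ in
               (I[ m ] u′ ≡ I × I[ m ] v′ ≡ I × SimOn I u′ v′) ×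
               (SimOn (∁ I) u′ (proj₁ t) × SimOn (∁ I) v′ (proj₂ t)))
  conclude {q} {r} {Ts = Ts} {I} r∈ Ts∈ I≢∅ sep =
    distinctOn (proj₁ r) I , distinctOn-pos (proj₁ r) I≢∅ ,
    λ t t∈ → (exact t∈ zero , exact t∈ (suc zero) , agree-inside t∈ zero (suc zero)) ,
             (agree-outside t∈ zero , agree-outside t∈ (suc zero))
    where
    open C.Separated q sep
    exact : ∀ {t} → S′ lex S t → ∀ c → I[ distinctOn (proj₁ r) I ] (comp₂ (C.chain q (r ∷ Ts) t) c) ≡ I
    exact {t} t∈ c =
      trans (cong (λ m → I[ m ] y) (distinctOn-cong (proj₁ r) y I same-ker)) (I[distinctOn]≡ (below t∈ c))
      where
      y = comp₂ (C.chain q (r ∷ Ts) t) c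
      same-ker = λ i j → ⇔-trans (S′-ker r∈ zero i j) (⇔-sym (C.chain-ker q (r∈ ∷ Ts∈) t∈ c i j))

lemma3p8 : (lex : ℚ → ℚ → ℚ) → IsLex lex →
  (ll : ℚ → ℚ → ℚ → ℚ) → (∀ q → IsLL q (ll q)) →
  (k : ℕ) (E S : Rel k) →
  Smooth E → PreservedByClone (bin→Op (ll 0ℚ)) E →
  (∀ t → S t → E t) → Smooth S →
  (t₁ : Tup k) → S′ lex S t₁ → MinClean t₁ →
  Σ (Subset k) λ I → Σ ℕ λ m → 1 ≤ m × Σ ℕ λ n′ → Σ ℚ λ q →
    Σ (Vec (Tup k) n′) λ rest → All (S′ lex S) rest ×
      (∀ t → S′ lex S t →
        let t′ = iterT (ll q) (t₁ ∷ (rest ∷ʳ t))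
            u′ = proj₁ t′
            v′ = proj₂ t′
        in (I[ m ] u′ ≡ I × I[ m ] v′ ≡ I × SimOn I u′ v′)
           × (SimOn (∁ I) u′ (proj₁ t) × SimOn (∁ I) v′ (proj₂ t)))
lemma3p8 _ _ _ _ zero _ _ _ _ _ _ _ _ _ =
  [] , 1 , s≤s z≤n , 0 , 0ℚ , [] , [] , λ _ _ → (refl , refl , λ ()) , ((λ ()) , (λ ()))
lemma3p8 _ isLex _ isLL (suc _) _ _ _ _ _ smooth _ t₁∈ clean =
  let q , I , I≢∅ , n , rest , rest∈ , sep = separating-chain-from t₁∈ clean zero
      m , 1≤m , properties = conclude t₁∈ rest∈ I≢∅ sep
  in I , m , 1≤m , n , q , rest , rest∈ , properties
  where open Construction isLex smooth isLL
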